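{- Let $D$ be a digraph each of whose weak components has a source. Then each weak component of $D$ is a star-generating digraph if and only if there exists an integer $m \geq 2$ such that each component of the $m$-step competition graph $C^m(D)$ is a nontrivial star graph whose center is a source in $D$. Moreover, if each weak component of $D$ is a star-generating digraph, then the conclusion holds also for $m=1$: each component of $C^1(D)$ is a nontrivial star graph whose center is a source in $D$.
   Context: All digraphs are finite, may have loops, and (standing assumption) every vertex has outdegree at least $1$. For a positive integer $m$, a vertex $y$ is an $m$-step prey of $x$ (and $x$ an $m$-step predator of $y$) if there is a directed walk of length $m$ from $x$ to $y$; $1$-step prey/predators are called prey/predators. The $m$-step competition graph $C^m(D)$ has vertex set $V(D)$ and an edge between distinct vertices $x,y$ iff they have a common $m$-step prey. A source is a vertex of indegree $0$. $D$ is weakly connected if its underlying undirected graph is connected; a weak component is the subdigraph induced by a component of the underlying graph. A weakly connected digraph $D$ is star-generating if: ($S_1$) $D$ has at least one source and, for each source $v$, each prey of $v$ has exactly two predators; ($S_2$) no two sources of $D$ have a common prey; ($S_3$) each non-source vertex has exactly one prey and exactly two predators, one of which is a source and the other of which is a non-source vertex. A star graph is $K_{1,r}$ ($r\ge 0$), with center the vertex of degree $r$; it is nontrivial if it has at least two vertices. -}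

module Defs where

open import Data.Nat using (ℕ; zero; suc; _≤_)
open import Data.Fin using (Fin)
open import Data.Bool using (Bool; T)
open import Data.Product using (Σ; ∃; ∃-syntax; _×_; _,_)
open import Data.Sum using (_⊎_)
open import Relation.Nullary using (¬_)
open import Relation.Binary.PropositionalEquality using (_≡_; _≢_)
open import Relation.Binary.Construct.Closure.ReflexiveTransitive using (Star)

-- A finite digraph (loops allowed) on vertex set Fin n, given by its
-- adjacency function: x → y is an arc iff T (D x y).
Digraph : ℕ → Set
Digraph n = Fin n → Fin n → Bool

module _ {n : ℕ} (D : Digraph n) where

  Arc : Fin n → Fin n → Set
  Arc x y = T (D x y)

  -- standing assumption: every vertex has outdegree at least 1
  OutdegPos : Set
  OutdegPos = ∀ x → ∃[ y ] Arc x y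

  data Walk : ℕ → Fin n → Fin n → Set where
    here : ∀ {x} → Walk zero x x
    step : ∀ {m x y z} → Arc x y → Walk m y z → Walk (suc m) x z

  Source : Fin n → Set
  Source v = ∀ u → ¬ Arc u v

  UArc : Fin n → Fin n → Set
  UArc x y = Arc x y ⊎ Arc y x

  WConn : Fin n → Fin n → Set
  WConn = Star UArc

  ExactlyOnePrey : Fin n → Set
  ExactlyOnePrey x = ∃[ y ] (Arc x y × (∀ z → Arc x z → z ≡ y))

  ExactlyTwoPredators : Fin n → Set
  ExactlyTwoPredators y =
    ∃[ a ] ∃[ b ] (a ≢ b × Arc a y × Arc b y × (∀ c → Arc c y → c ≡ a ⊎ c ≡ b))

  TwoPredatorsSourceNonSource : Fin n → Set
  TwoPredatorsSourceNonSource y =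
    ∃[ a ] ∃[ b ] (a ≢ b × Arc a y × Arc b y × (∀ c → Arc c y → c ≡ a ⊎ c ≡ b)
                   × Source a × ¬ Source b)

  -- The weak component C (a vertex set closed under arcs in both directions,
  -- so prey/predators/sources computed in D coincide with those computed in
  -- the induced subdigraph) is a star-generating digraph.
  StarGeneratingOn : (Fin n → Set) → Set
  StarGeneratingOn C =
    -- (S1)
    (∃[ v ] (C v × Source v))
    × (∀ v → C v → Source v → ∀ y → Arc v y → ExactlyTwoPredators y)
    -- (S2)
    × (∀ u v → C u → C v → Source u → Source v → u ≢ v →
         ∀ y → ¬ (Arc u y × Arc v y))
    -- (S3)
    × (∀ x → C x → ¬ Source x →
         ExactlyOnePrey x × TwoPredatorsSourceNonSource x)

  CompEdge : ℕ → Fin n → Fin n → Set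
  CompEdge m x y = x ≢ y × ∃[ z ] (Walk m x z × Walk m y z)

  CompConn : ℕ → Fin n → Fin n → Set
  CompConn m = Star (CompEdge m)

  NontrivialStarWithCenter : ℕ → (Fin n → Set) → Fin n → Set
  NontrivialStarWithCenter m K c =
    K c
    × (∃[ y ] (K y × y ≢ c))
    × (∀ y → K y → y ≢ c → CompEdge m c y)
    × (∀ y z → K y → K z → y ≢ c → z ≢ c → ¬ CompEdge m y z)

  CompStars : ℕ → Set
  CompStars m =
    ∀ x → ∃[ c ] (Source c × NontrivialStarWithCenter m (CompConn m x) c)

{-# OPTIONS --safe #-}
module Submission where

-- If D satisfies (S2) and (S3), every non-source has exactly one non-source
-- predator, so two walks of equal length into the same vertex that start at
-- non-sources start at the same vertex.  Hence for every m ≥ 1 two vertices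
-- compete in C^m(D) iff they have a common prey, and the component of C^m(D)
-- containing a source s consists of s and the non-sources sharing a prey with s.
-- Conversely, if the components of C^m(D) are stars centred at sources, no two
-- non-sources compete; so sending each non-source to one of its m-step prey and
-- fixing the sources is an injective, hence bijective, self-map of V(D).  Thus
-- every non-source has exactly one m-step prey and exactly one non-source m-step
-- predator, from which (S2) and (S3) follow.

open import Defs
open import Data.Nat using (ℕ; zero; suc; _≤_)
open import Data.Nat.Properties using (1+n≰n; ≤-refl)
open import Data.Fin using (Fin; _≟_; punchOut)
open import Data.Fin.Properties using (all?; any?; punchOut-injective; injective⇒≤)
open import Data.Product using (∃; ∃-syntax; _×_; _,_; proj₁; proj₂)
open import Data.Sum using (_⊎_; inj₁; inj₂)
open import Data.Empty using (⊥)
open import Function.Bundles using (_⇔_; mk⇔)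
open import Function.Definitions using (Injective)
open import Relation.Nullary using (¬_; Dec; yes; no; contradiction)
open import Relation.Nullary.Decidable.Core using (T?; ¬?; toSum)
open import Relation.Binary.PropositionalEquality using (_≡_; _≢_; refl; sym; trans; subst; ≢-sym)
open import Relation.Binary.Construct.Closure.ReflexiveTransitive using (ε; _◅◅_; fold; reverse; return)

injective⇒hasPreimage : ∀ {n} {f : Fin n → Fin n} → Injective _≡_ _≡_ f → ∀ y → ∃[ x ] f x ≡ y
injective⇒hasPreimage {suc n} {f} f-injective y with any? (λ x → f x ≟ y)
... | yes hit = hit
... | no miss = contradiction (injective⇒≤ punched-injective) 1+n≰n
  where
  y≢f : ∀ x → y ≢ f x
  y≢f x y≡fx = miss (x , sym y≡fx)

  punched-injective : Injective _≡_ _≡_ (λ x → punchOut (y≢f x))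
  punched-injective eq = f-injective (punchOut-injective (y≢f _) (y≢f _) eq)

module _ {n : ℕ} (D : Digraph n) where

  NonSource : Fin n → Set
  NonSource x = ¬ Source D x

  source? : ∀ x → Dec (Source D x)
  source? x = all? (λ u → ¬? (T? (D u x)))

  arc⇒nonSource : ∀ {x y} → Arc D x y → NonSource y
  arc⇒nonSource {x} xy y-source = y-source x xy

  nonSource≢source : ∀ {a s} → NonSource a → Source D s → a ≢ s
  nonSource≢source na ss refl = na ss

  walk-snoc : ∀ {k x v u} → Walk D k x v → Arc D v u → Walk D (suc k) x u
  walk-snoc here vu = step vu here
  walk-snoc (step xy w) vu = step xy (walk-snoc w vu)

  walk-unsnoc : ∀ {k x u} → Walk D (suc k) x u → ∃[ v ] (Walk D k x v × Arc D v u)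
  walk-unsnoc (step xu here) = _ , here , xu
  walk-unsnoc (step xy w@(step _ _)) with walk-unsnoc w
  ... | v , w′ , vu = v , step xy w′ , vu

  walk⇒nonSource : ∀ {k x u} → Walk D (suc k) x u → NonSource u
  walk⇒nonSource w = arc⇒nonSource (proj₂ (proj₂ (walk-unsnoc w)))

  walk-preserves-nonSource : ∀ {k x v} → NonSource x → Walk D k x v → NonSource v
  walk-preserves-nonSource nx here = nx
  walk-preserves-nonSource _ (step xy w) = walk-preserves-nonSource (arc⇒nonSource xy) w

  compEdge-sym : ∀ {m a b} → CompEdge D m a b → CompEdge D m b a
  compEdge-sym (a≢b , u , wa , wb) = ≢-sym a≢b , u , wb , wa

  NonSourcePredatorsUnique : Set
  NonSourcePredatorsUnique =
    ∀ {a b y} → NonSource a → NonSource b → Arc D a y → Arc D b y → a ≡ b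

  walks-backward-unique : NonSourcePredatorsUnique →
    ∀ {k a b u} → NonSource a → NonSource b → Walk D k a u → Walk D k b u → a ≡ b
  walks-backward-unique unique na nb here here = refl
  walks-backward-unique unique na nb (step ay w) (step by w′)
    with walks-backward-unique unique (arc⇒nonSource ay) (arc⇒nonSource by) w w′
  ... | refl = unique na nb ay by

  module _ {y : Fin n} where

    twoPredators⇒sourcePredator :
      TwoPredatorsSourceNonSource D y → ∃[ s ] (Source D s × Arc D s y)
    twoPredators⇒sourcePredator (s , _ , _ , sy , _ , _ , ss , _) = s , ss , sy

    twoPredators⇒nonSourcePredator :
      TwoPredatorsSourceNonSource D y → ∃[ z ] (NonSource z × Arc D z y)
    twoPredators⇒nonSourcePredator (_ , z , _ , _ , zy , _ , _ , nz) = z , nz , zy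

    twoPredators⇒nonSourcePredators-unique : TwoPredatorsSourceNonSource D y →
      ∀ {a b} → NonSource a → NonSource b → Arc D a y → Arc D b y → a ≡ b
    twoPredators⇒nonSourcePredators-unique (_ , _ , _ , _ , _ , only , ss , _) na nb ay by
      with only _ ay | only _ by
    ... | inj₂ refl | inj₂ refl = refl
    ... | inj₁ refl | _ = contradiction ss na
    ... | inj₂ _ | inj₁ refl = contradiction ss nb

    twoPredators⇒exactlyTwo : TwoPredatorsSourceNonSource D y → ExactlyTwoPredators D y
    twoPredators⇒exactlyTwo (s , z , s≢z , sy , zy , only , _ , _) = s , z , s≢z , sy , zy , only

  -- (S2) and (S3) imposed on all of D; the second half of (S1) follows from
  -- (S3), since the prey of a source is not a source.
  record StarGeneratingConditions : Set where
    field
      sourcePredators-unique :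
        ∀ {s s′ y} → Source D s → Source D s′ → Arc D s y → Arc D s′ y → s ≡ s′
      nonSource-onePrey : ∀ {x} → NonSource x → ExactlyOnePrey D x
      nonSource-predators : ∀ {y} → NonSource y → TwoPredatorsSourceNonSource D y

  components⇒conditions :
    (∀ x → StarGeneratingOn D (WConn D x)) → StarGeneratingConditions
  components⇒conditions starGenerating = record
    { sourcePredators-unique = sourcePredators-unique
    ; nonSource-onePrey = λ {x} nx → proj₁ (S3 x nx)
    ; nonSource-predators = λ {y} ny → proj₂ (S3 y ny)
    }
    where
    S3 : ∀ x → NonSource x → ExactlyOnePrey D x × TwoPredatorsSourceNonSource D x
    S3 x = proj₂ (proj₂ (proj₂ (starGenerating x))) x ε

    sourcePredators-unique :
      ∀ {s s′ y} → Source D s → Source D s′ → Arc D s y → Arc D s′ y → s ≡ s′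
    sourcePredators-unique {s} {s′} {y} ss ss′ sy s′y with s ≟ s′
    ... | yes s≡s′ = s≡s′
    ... | no s≢s′ = contradiction (sy , s′y)
      (proj₁ (proj₂ (proj₂ (starGenerating s))) s s′ ε (return (inj₁ sy) ◅◅ return (inj₂ s′y))
        ss ss′ s≢s′ y)

  conditions⇒components : (∀ x → ∃[ s ] (WConn D x s × Source D s)) →
    StarGeneratingConditions → ∀ x → StarGeneratingOn D (WConn D x)
  conditions⇒components hasSource conditions x =
      hasSource x
    , (λ _ _ _ _ vy → twoPredators⇒exactlyTwo (nonSource-predators (arc⇒nonSource vy)))
    , (λ _ _ _ _ su sv u≢v _ (uy , vy) → u≢v (sourcePredators-unique su sv uy vy))
    , (λ _ _ nx → nonSource-onePrey nx , nonSource-predators nx)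
    where open StarGeneratingConditions conditions

  module StarsFromCenter
    (m : ℕ)
    (center : Fin n → Fin n)
    (center-source : ∀ x → Source D (center x))
    (center-fixes-source : ∀ {x} → Source D x → center x ≡ x)
    (compEdge⇒sameCenter : ∀ {a b} → CompEdge D m a b → center a ≡ center b)
    (center-adjacent : ∀ {y} → NonSource y → CompEdge D m (center y) y)
    (nonSources-independent : ∀ {a b} → NonSource a → NonSource b → ¬ CompEdge D m a b)
    (source-hasLeaf : ∀ {s} → Source D s → ∃[ y ] (NonSource y × center y ≡ s))
    where

    compConn⇒sameCenter : ∀ {x y} → CompConn D m x y → center x ≡ center y
    compConn⇒sameCenter =
      fold (λ x y → center x ≡ center y) (λ e eq → trans (compEdge⇒sameCenter e) eq) refl

    compConn-center : ∀ x → CompConn D m x (center x)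
    compConn-center x with source? x
    ... | yes sx = subst (CompConn D m x) (sym (center-fixes-source sx)) ε
    ... | no nx = return (compEdge-sym (center-adjacent nx))

    sameCenter⇒compConn : ∀ {x y} → center x ≡ center y → CompConn D m x y
    sameCenter⇒compConn {x} {y} eq =
      compConn-center x ◅◅ subst (λ c → CompConn D m c y) (sym eq)
                                 (reverse compEdge-sym (compConn-center y))

    offCenter⇒nonSource : ∀ {y c} → center y ≡ c → y ≢ c → NonSource y
    offCenter⇒nonSource eq y≢c sy = y≢c (trans (sym (center-fixes-source sy)) eq)

    compStars : CompStars D m
    compStars x = center x , center-source x , compConn-center x , leaf , adjacent , independent
      where
      offCenter : ∀ {y} → CompConn D m x y → y ≢ center x → NonSource y
      offCenter xy = offCenter⇒nonSource (sym (compConn⇒sameCenter xy))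

      leaf : ∃[ y ] (CompConn D m x y × y ≢ center x)
      leaf with source-hasLeaf (center-source x)
      ... | y , ny , cy≡cx = y , sameCenter⇒compConn (sym cy≡cx)
                               , nonSource≢source ny (center-source x)

      adjacent : ∀ y → CompConn D m x y → y ≢ center x → CompEdge D m (center x) y
      adjacent y xy y≢c = subst (λ c → CompEdge D m c y) (sym (compConn⇒sameCenter xy))
                                (center-adjacent (offCenter xy y≢c))

      independent : ∀ y z → CompConn D m x y → CompConn D m x z →
                    y ≢ center x → z ≢ center x → ¬ CompEdge D m y z
      independent y z xy xz y≢c z≢c =
        nonSources-independent (offCenter xy y≢c) (offCenter xz z≢c)

  module _ (outdeg : OutdegPos D) where

    walk-exists : ∀ k x → ∃[ u ] Walk D k x u
    walk-exists zero x = x , here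
    walk-exists (suc k) x with outdeg x
    ... | y , xy with walk-exists k y
    ... | u , w = u , step xy w

    commonPrey⇒compEdge : ∀ k {a b y} → a ≢ b → Arc D a y → Arc D b y → CompEdge D (suc k) a b
    commonPrey⇒compEdge k {y = y} a≢b ay by with walk-exists k y
    ... | u , w = a≢b , u , step ay w , step by w

    module Forward (conditions : StarGeneratingConditions) where
      open StarGeneratingConditions conditions

      prey : Fin n → Fin n
      prey x = proj₁ (outdeg x)

      nonSource-preyUnique : ∀ {x y} → NonSource x → Arc D x y → y ≡ prey x
      nonSource-preyUnique nx xy with nonSource-onePrey nx
      ... | _ , _ , only = trans (only _ xy) (sym (only _ (proj₂ (outdeg _))))

      nonSourcePredators-unique : NonSourcePredatorsUnique
      nonSourcePredators-unique na nb ay by =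
        twoPredators⇒nonSourcePredators-unique (nonSource-predators (arc⇒nonSource ay)) na nb ay by

      compEdge⇒commonPrey : ∀ {k a b} → CompEdge D (suc k) a b → ∃[ y ] (Arc D a y × Arc D b y)
      compEdge⇒commonPrey (_ , _ , step ay w , step by w′)
        with walks-backward-unique nonSourcePredators-unique (arc⇒nonSource ay) (arc⇒nonSource by) w w′
      ... | refl = _ , ay , by

      preySourcePredator : ∀ x → ∃[ s ] (Source D s × Arc D s (prey x))
      preySourcePredator x =
        twoPredators⇒sourcePredator (nonSource-predators (arc⇒nonSource (proj₂ (outdeg x))))

      center : Fin n → Fin n
      center x with source? x
      ... | yes _ = x
      ... | no _ = proj₁ (preySourcePredator x)

      center-source : ∀ x → Source D (center x)
      center-source x with source? x
      ... | yes sx = sx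
      ... | no _ = proj₁ (proj₂ (preySourcePredator x))

      center-fixes-source : ∀ {x} → Source D x → center x ≡ x
      center-fixes-source {x} sx with source? x
      ... | yes _ = refl
      ... | no nx = contradiction sx nx

      center-preyArc : ∀ {x} → NonSource x → Arc D (center x) (prey x)
      center-preyArc {x} nx with source? x
      ... | yes sx = contradiction sx nx
      ... | no _ = proj₂ (proj₂ (preySourcePredator x))

      source-commonPrey⇒center :
        ∀ {s b y} → Source D s → NonSource b → Arc D s y → Arc D b y → s ≡ center b
      source-commonPrey⇒center ss nb sy by with nonSource-preyUnique nb by
      ... | refl = sourcePredators-unique ss (center-source _) sy (center-preyArc nb)

      compEdge⇒sameCenter : ∀ {k a b} → CompEdge D (suc k) a b → center a ≡ center b
      -- Splitting on toSum (source? _) rather than source? _ keeps center a and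
      -- center b from being with-abstracted.
      compEdge⇒sameCenter {a = a} {b} e@(a≢b , _)
        with compEdge⇒commonPrey e | toSum (source? a) | toSum (source? b)
      ... | _ , ay , by | inj₁ sa | inj₁ sb = contradiction (sourcePredators-unique sa sb ay by) a≢b
      ... | _ , ay , by | inj₁ sa | inj₂ nb =
        trans (center-fixes-source sa) (source-commonPrey⇒center sa nb ay by)
      ... | _ , ay , by | inj₂ na | inj₁ sb =
        sym (trans (center-fixes-source sb) (source-commonPrey⇒center sb na by ay))
      ... | _ , ay , by | inj₂ na | inj₂ nb = contradiction (nonSourcePredators-unique na nb ay by) a≢b

      center-adjacent : ∀ {k y} → NonSource y → CompEdge D (suc k) (center y) y
      center-adjacent {k} {y} ny =
        commonPrey⇒compEdge k (≢-sym (nonSource≢source ny (center-source y)))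
                              (center-preyArc ny) (proj₂ (outdeg y))

      nonSources-independent : ∀ {k a b} → NonSource a → NonSource b → ¬ CompEdge D (suc k) a b
      nonSources-independent na nb e@(a≢b , _) with compEdge⇒commonPrey e
      ... | _ , ay , by = a≢b (nonSourcePredators-unique na nb ay by)

      source-hasLeaf : ∀ {s} → Source D s → ∃[ y ] (NonSource y × center y ≡ s)
      source-hasLeaf {s} ss
        with twoPredators⇒nonSourcePredator (nonSource-predators (arc⇒nonSource (proj₂ (outdeg s))))
      ... | z , nz , zy = z , nz , sym (source-commonPrey⇒center ss nz (proj₂ (outdeg s)) zy)

      compStars : ∀ k → CompStars D (suc k)
      compStars k = StarsFromCenter.compStars (suc k) center center-source center-fixes-source
        compEdge⇒sameCenter center-adjacent nonSources-independent source-hasLeaf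

    module Converse (k : ℕ) (stars : CompStars D (suc k)) where

      m : ℕ
      m = suc k

      nonSources-independent : ∀ {a b} → NonSource a → NonSource b → ¬ CompEdge D m a b
      nonSources-independent {a} {b} na nb ab with stars a
      ... | c , sc , _ , _ , _ , leaves-independent =
        leaves-independent a b ε (return ab) (nonSource≢source na sc) (nonSource≢source nb sc) ab

      mWalks-injective : ∀ {a b u} → NonSource a → NonSource b → Walk D m a u → Walk D m b u → a ≡ b
      mWalks-injective {a} {b} na nb wa wb with a ≟ b
      ... | yes a≡b = a≡b
      ... | no a≢b = contradiction (a≢b , _ , wa , wb) (nonSources-independent na nb)

      mPrey : Fin n → Fin n
      mPrey x = proj₁ (walk-exists m x)

      mPrey-walk : ∀ x → Walk D m x (mPrey x)
      mPrey-walk x = proj₂ (walk-exists m x)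

      sourceOrMPrey : Fin n → Fin n
      sourceOrMPrey x with source? x
      ... | yes _ = x
      ... | no _ = mPrey x

      sourceOrMPrey-injective : Injective _≡_ _≡_ sourceOrMPrey
      sourceOrMPrey-injective {a} {b} eq with source? a | source? b
      ... | yes _ | yes _ = eq
      ... | yes sa | no _ = contradiction (subst (Source D) eq sa) (walk⇒nonSource (mPrey-walk b))
      ... | no _ | yes sb = contradiction (subst (Source D) (sym eq) sb) (walk⇒nonSource (mPrey-walk a))
      ... | no na | no nb = mWalks-injective na nb (mPrey-walk a) (subst (Walk D m b) (sym eq) (mPrey-walk b))

      nonSource-hasMPredator : ∀ {u} → NonSource u → ∃[ x ] (NonSource x × mPrey x ≡ u)
      nonSource-hasMPredator {u} nu with injective⇒hasPreimage sourceOrMPrey-injective u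
      ... | x , eq with source? x
      ... | yes sx = contradiction (subst (Source D) eq sx) nu
      ... | no nx = x , nx , eq

      mPrey-unique : ∀ {x u} → NonSource x → Walk D m x u → u ≡ mPrey x
      mPrey-unique nx w with nonSource-hasMPredator (walk⇒nonSource w)
      ... | x′ , nx′ , refl with mWalks-injective nx nx′ w (mPrey-walk x′)
      ... | refl = refl

      nonSource-onePrey : ∀ {x} → NonSource x → ExactlyOnePrey D x
      nonSource-onePrey {x} nx =
        proj₁ (outdeg x) , proj₂ (outdeg x) , λ _ xy → prey-unique xy (proj₂ (outdeg x))
        where
        prey-unique : ∀ {y₁ y₂} → Arc D x y₁ → Arc D x y₂ → y₁ ≡ y₂
        prey-unique {y₁} {y₂} xy₁ xy₂ with walk-exists k y₁ | walk-exists k y₂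
        ... | u₁ , w₁ | u₂ , w₂
          with trans (mPrey-unique nx (step xy₁ w₁)) (sym (mPrey-unique nx (step xy₂ w₂)))
        ... | refl = mWalks-injective (arc⇒nonSource xy₁) (arc⇒nonSource xy₂)
                       (walk-snoc w₁ (proj₂ (outdeg u₁))) (walk-snoc w₂ (proj₂ (outdeg u₁)))

      nonSourcePredators-unique : NonSourcePredatorsUnique
      nonSourcePredators-unique {y = y} na nb ay by with walk-exists k y
      ... | _ , w = mWalks-injective na nb (step ay w) (step by w)

      nonSource-hasNonSourcePredator : ∀ {y} → NonSource y → ∃[ z ] (NonSource z × Arc D z y)
      nonSource-hasNonSourcePredator ny with nonSource-hasMPredator ny
      ... | x , nx , refl with walk-unsnoc (mPrey-walk x)
      ... | v , xv , vy = v , walk-preserves-nonSource nx xv , vy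

      sources-noCommonMPrey :
        ∀ {s s′ u} → Source D s → Source D s′ → s ≢ s′ → Walk D m s u → Walk D m s′ u → ⊥
      sources-noCommonMPrey {s} ss ss′ s≢s′ ws ws′ with nonSource-hasMPredator (walk⇒nonSource ws)
      ... | x , nx , refl with stars x
      ... | c , sc , _ , _ , _ , leaves-independent with s ≟ c
      ... | yes refl = leaves-independent x _ ε (return xs′) (nonSource≢source nx sc) (≢-sym s≢s′) xs′
        where xs′ = nonSource≢source nx ss′ , _ , mPrey-walk x , ws′
      ... | no s≢c = leaves-independent x s ε (return xs) (nonSource≢source nx sc) s≢c xs
        where xs = nonSource≢source nx ss , _ , mPrey-walk x , ws

      sourcePredators-unique :
        ∀ {s s′ y} → Source D s → Source D s′ → Arc D s y → Arc D s′ y → s ≡ s′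
      sourcePredators-unique {s} {s′} {y} ss ss′ sy s′y with s ≟ s′ | walk-exists k y
      ... | yes s≡s′ | _ = s≡s′
      ... | no s≢s′ | _ , w = contradiction (step s′y w) (sources-noCommonMPrey ss ss′ s≢s′ (step sy w))

      -- The center c of the component of a non-source predator z of y is
      -- adjacent to z; since z has only one m-step prey, c's walk to it passes
      -- through y after one step.
      nonSource-hasSourcePredator : ∀ {y} → NonSource y → ∃[ s ] (Source D s × Arc D s y)
      nonSource-hasSourcePredator {y} ny with nonSource-hasNonSourcePredator ny
      ... | z , nz , zy with stars z
      ... | c , sc , _ , _ , adjacent , _ with adjacent z ε (nonSource≢source nz sc) | walk-exists k y
      ... | _ , _ , step cv wv , wz | _ , wy
        with trans (mPrey-unique nz wz) (sym (mPrey-unique nz (step zy wy)))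
      ... | refl with walks-backward-unique nonSourcePredators-unique (arc⇒nonSource cv) ny wv wy
      ... | refl = c , sc , cv

      nonSource-predators : ∀ {y} → NonSource y → TwoPredatorsSourceNonSource D y
      nonSource-predators {y} ny with nonSource-hasSourcePredator ny | nonSource-hasNonSourcePredator ny
      ... | s , ss , sy | z , nz , zy = s , z , ≢-sym (nonSource≢source nz ss) , sy , zy , only , ss , nz
        where
        only : ∀ c → Arc D c y → c ≡ s ⊎ c ≡ z
        only c cy with source? c
        ... | yes sc = inj₁ (sourcePredators-unique sc ss cy sy)
        ... | no nc = inj₂ (nonSourcePredators-unique nc nz cy zy)

      conditions : StarGeneratingConditions
      conditions = record
        { sourcePredators-unique = sourcePredators-unique
        ; nonSource-onePrey = nonSource-onePrey
        ; nonSource-predators = nonSource-predators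
        }

theorem1p2 : ∀ {n} (D : Digraph n) → OutdegPos D →
    (∀ x → ∃[ s ] (WConn D x s × Source D s)) →
    ((∀ x → StarGeneratingOn D (WConn D x)) ⇔ (∃[ m ] (2 ≤ m × CompStars D m)))
    × ((∀ x → StarGeneratingOn D (WConn D x)) → CompStars D 1)
theorem1p2 D outdeg hasSource = mk⇔ (λ sg → 2 , ≤-refl , stars sg 1) converse , (λ sg → stars sg 0)
  where
  stars : (∀ x → StarGeneratingOn D (WConn D x)) → ∀ k → CompStars D (suc k)
  stars sg = Forward.compStars D outdeg (components⇒conditions D sg)

  converse : ∃[ m ] (2 ≤ m × CompStars D m) → ∀ x → StarGeneratingOn D (WConn D x)
  -- The bound 2 ≤ m only excludes m = 0; Converse works for every m ≥ 1.
  converse (suc k , _ , cs) = conditions⇒components D hasSource (Converse.conditions D outdeg k cs)
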